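{- Let $t\geq 4$. There exists $r_t\geq\binom{t}{2}$ such that for all $r\geq r_t$, $K_t$ is $r$-rainbow-uncommon.
   Context: All graphs are simple. A copy of a graph $H$ in a graph $G$ is a subgraph of $G$ isomorphic to $H$. An $r$-coloring of a set $X$ is a surjective function $c:X\to\{1,\dots,r\}$. Under an edge-coloring of $G$, a subgraph $H$ is rainbow if all edges of $H$ receive pairwise distinct colors. For a graph $H$ with $e$ edges, let $M_{\mathrm{rb}}(H;n,r)$ be the maximum, over all $r$-colorings of $E(K_n)$, of the number of rainbow copies of $H$ in $K_n$; let $m_{\mathrm{rb}}(H;n,r)=M_{\mathrm{rb}}(H;n,r)/(\text{number of copies of } H \text{ in } K_n)$ and $m_{\mathrm{rb}}(H;r)=\lim_{n\to\infty} m_{\mathrm{rb}}(H;n,r)$ (this limit exists). $H$ is called $r$-rainbow-common if $m_{\mathrm{rb}}(H;r)=\binom{r}{e}e!/r^e$, and $r$-rainbow-uncommon otherwise. -}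

module Defs where

open import Data.Nat using (ℕ; zero; suc; _^_; _≤_; _!)
open import Data.Nat.Combinatorics using (_C_)
import Data.Nat as ℕ
open import Data.Integer using (+_)
open import Data.Rational using (ℚ; 0ℚ; _/_; _-_; ∣_∣; _<_)
open import Data.Fin using (Fin; toℕ)
open import Data.Fin.Properties using (_≟_)
open import Data.List using (List; []; _∷_; [_]; map; _++_; length; filter; allFin)
open import Data.List.Relation.Unary.Unique.Propositional using (Unique)
import Data.List.Relation.Unary.Unique.DecPropositional as UD
open import Data.Product using (_×_; _,_; Σ; ∃-syntax)
open import Relation.Binary.PropositionalEquality using (_≡_)
open import Relation.Nullary using (¬_)

-- a / b as a rational, with the convention a / 0 = 0 (only used for b = 0
-- when n < t, i.e. irrelevant for the limit n → ∞)
frac : ℕ → ℕ → ℚ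
frac a zero = 0ℚ
frac a (suc b) = (+ a) / suc b

combinations : {A : Set} → ℕ → List A → List (List A)
combinations zero xs = [ [] ]
combinations (suc k) [] = []
combinations (suc k) (x ∷ xs) = map (x ∷_) (combinations k xs) ++ combinations (suc k) xs

pairs : {A : Set} → List A → List (A × A)
pairs [] = []
pairs (x ∷ xs) = map (λ y → (x , y)) xs ++ pairs xs

-- An edge-colouring of K_n with colours Fin r: the edge {i,j}, i < j, gets
-- colour c i j (values of c i j with i ≥ j are irrelevant).
EdgeCol : ℕ → ℕ → Set
EdgeCol n r = Fin n → Fin n → Fin r

IsRColoring : (n r : ℕ) → EdgeCol n r → Set
IsRColoring n r c = (k : Fin r) → ∃[ i ] ∃[ j ] (toℕ i ℕ.< toℕ j × c i j ≡ k)

edgeColours : {n r : ℕ} → EdgeCol n r → List (Fin n) → List (Fin r)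
edgeColours c S = map (λ e → c (Data.Product.proj₁ e) (Data.Product.proj₂ e)) (pairs S)

-- number of rainbow copies of K_t in K_n under c
-- (copies of K_t in K_n correspond to t-subsets of the vertex set)
rainbowCount : (t : ℕ) {n r : ℕ} → EdgeCol n r → ℕ
rainbowCount t {n} {r} c =
  length (filter (λ S → UD.unique? (_≟_ {r}) (edgeColours c S)) (combinations t (allFin n)))

IsMaxRainbow : (t n r M : ℕ) → Set
IsMaxRainbow t n r M =
  (∃[ c ] (IsRColoring n r c × rainbowCount t c ≡ M))
  × ((c : EdgeCol n r) → IsRColoring n r c → rainbowCount t c ≤ M)

RainbowRatioTendsTo : (t r : ℕ) → ℚ → Set
RainbowRatioTendsTo t r L =
  (ε : ℚ) → 0ℚ < ε → ∃[ N ] ((n : ℕ) → N ≤ n → (M : ℕ) → IsMaxRainbow t n r M →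
    ∣ frac M (n C t) - L ∣ < ε)

commonValue : (t r : ℕ) → ℚ
commonValue t r = frac ((r C (t C 2)) ℕ.* ((t C 2) !)) (r ^ (t C 2))

-- K_t is r-rainbow-uncommon: m_rb(K_t; r) ≠ commonValue t r.
-- Since the limit m_rb(K_t; r) exists, this is equivalent to the
-- sequence m_rb(K_t; n, r) not converging to commonValue t r.
RainbowUncommon : (t r : ℕ) → Set
RainbowUncommon t r = ¬ RainbowRatioTendsTo t r (commonValue t r)

module Submission where

-- Colour K_n, n = m r, by labelling vertex v with v mod r and giving the edge uv the colour
-- label u + label v in ℤ/r. A vertex set T of size k with distinct labels and distinct edge colours
-- stays so when a vertex x is added unless label x is one of F k = k + k C(k-1,2) forbidden values:
-- the labels of T, and label p + label q - label y for y ∈ T and {p, q} ⊆ T - y. Every label is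
-- carried by m vertices, so greedily there are at least ∏_{k<t} m (r - F k) ordered rainbow t-tuples,
-- and the density of rainbow K_t is at least ∏_{k<t} (1 - F k / r) ≥ 1 - B / r, B = Σ_{k<t} F k.
-- The common value r (r-1) ⋯ (r-e+1) / r^e, e = C(t,2), is at most r / (r + C(e,2)). For t ≥ 4,
-- B < C(e,2), so for r > B C(e,2) the density exceeds the common value by 1 / (r (r + C(e,2))) for
-- every n = m r, and m_rb(K_t; n, r) cannot tend to it.

open import Defs
open import Data.Nat using (ℕ; zero; suc; pred; _+_; _*_; _∸_; _^_; _≤_; _<_; z≤n; s≤s; z<s; _≤?_; _!; NonZero; >-nonZero⁻¹)
open import Data.Nat.Properties hiding (_≟_)
open import Data.Nat.DivMod using (_/_; _%_; _mod_; m/n*n≤m; m%n<n; %-distribˡ-+; m%n%n≡m%n; [m+n]%n≡m%n; m<n⇒m%n≡m)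
open import Data.Nat.Combinatorics using (_C_; nC1≡n; nCk+nC[k+1]≡[n+1]C[k+1]; nCk≡nPk/k!; nPk≡n!/[n∸k]!; k>n⇒nCk≡0)
open import Data.Nat.Combinatorics.Base using (_P′_)
open import Data.Nat.Combinatorics.Specification using (nP′k≡n!/[n∸k]!)
open import Data.Nat.ListAction using (sum)
open import Data.Nat.Tactic.RingSolver using (solve-∀)
import Data.Integer as ℤ
import Data.Integer.Properties as ℤ
open import Data.Rational as ℚ using (0ℚ; toℚᵘ) renaming (_+_ to _+ℚ_; _-_ to _-ℚ_; _≤_ to _≤ℚ_; _<_ to _<ℚ_)
import Data.Rational.Properties as ℚ
open import Data.Rational.Unnormalised as ℚᵘ using (mkℚᵘ) renaming (_≃_ to _≃ᵘ_)
import Data.Rational.Unnormalised.Properties as ℚᵘ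
open import Data.Fin using (Fin; toℕ; fromℕ<; combine; remainder; quotient)
open import Data.Fin.Properties using (_≟_; toℕ-injective; toℕ-fromℕ<; toℕ<n; combine-remQuot; remQuot-combine; combine-monoˡ-<)
open import Data.Product using (_×_; _,_; ∃-syntax; proj₁; proj₂)
import Data.Product as Product
open import Data.Sum using (_⊎_; inj₁; inj₂; [_,_]′)
open import Data.Empty using (⊥-elim)
open import Data.List using (List; []; _∷_; [_]; map; _++_; length; filter; concatMap; cartesianProductWith; allFin)
open import Data.List.Properties using (length-++; length-map; length-filter; length-tabulate; ∷-injective; map-++; map-∘; filter-++; filter-all; filter-none)
open import Data.List.Membership.Propositional using (_∈_; _∉_; lose)
open import Data.List.Membership.Propositional.Properties
  using (∈-∃++; ∈-map⁺; ∈-map⁻; ∈-++⁻; ∈-++⁺ˡ; ∈-++⁺ʳ; ∈-concatMap⁺; ∈-cartesianProductWith⁻; ∈-filter⁺; ∈-filter⁻; ∈-allFin)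
open import Data.List.Relation.Unary.Any using (here; there)
open import Data.List.Relation.Unary.All as All using (All; []; _∷_)
import Data.List.Relation.Unary.All.Properties as All
open import Data.List.Relation.Unary.All.Properties using (¬Any⇒All¬)
open import Data.List.Relation.Unary.AllPairs as AllPairs using ([]; _∷_)
open import Data.List.Relation.Unary.Unique.Propositional using (Unique)
import Data.List.Relation.Unary.Unique.Propositional.Properties as Unique
open import Data.List.Relation.Unary.Unique.Propositional.Properties using (allFin⁺)
import Data.List.Relation.Unary.Unique.DecPropositional as UniqueDec
open import Data.List.Relation.Binary.Subset.Propositional using (_⊆_)
open import Data.List.Relation.Binary.Disjoint.Propositional using (Disjoint)
open import Data.List.Relation.Binary.Permutation.Propositional using (_↭_; ↭-refl; ↭-prep; ↭-swap; ↭-trans; ↭-sym; ↭⇒↭ₛ)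
import Data.List.Relation.Binary.Permutation.Propositional as ↭
open import Data.List.Relation.Binary.Permutation.Propositional.Properties using (↭-length; shift; shifts; ++⁺; ∈-resp-↭)
  renaming (map⁺ to ↭-map⁺)
open import Data.List.Relation.Binary.Permutation.Setoid.Properties using (Unique-resp-↭)
open import Function using (_∘_; id)
open import Level using (0ℓ)
open import Relation.Nullary using (¬_; yes; no; contradiction; _×-dec_)
open import Relation.Unary using (Pred; Decidable; ∁; U)
open import Relation.Unary.Properties using (U?)
open import Relation.Binary.Definitions using (_Respects_; DecidableEquality)
open import Relation.Binary.PropositionalEquality
  using (_≡_; _≢_; refl; sym; trans; cong; cong₂; subst; subst₂; setoid; module ≡-Reasoning)

module _ {A : Set} where

  count : {P : Pred A 0ℓ} → Decidable P → List A → ℕ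
  count P? xs = length (filter P? xs)

  module _ {P : Pred A 0ℓ} (P? : Decidable P) where

    count-++ : (xs ys : List A) → count P? (xs ++ ys) ≡ count P? xs + count P? ys
    count-++ xs ys = trans (cong length (filter-++ P? xs ys)) (length-++ (filter P? xs))

    count-all : {xs : List A} → All P xs → count P? xs ≡ length xs
    count-all = cong length ∘ filter-all P?

    count-none : {xs : List A} → All (∁ P) xs → count P? xs ≡ 0
    count-none = cong length ∘ filter-none P?

    count-*-≤-sum : (g : A → ℕ) (b : ℕ) (xs : List A) → (∀ {x} → x ∈ xs → P x → b ≤ g x) →
                    count P? xs * b ≤ sum (map g xs)
    count-*-≤-sum g b [] h = z≤n
    count-*-≤-sum g b (x ∷ xs) h with P? x
    ... | yes px = +-mono-≤ (h (here refl) px) (count-*-≤-sum g b xs (h ∘ there))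
    ... | no _   = ≤-trans (count-*-≤-sum g b xs (h ∘ there)) (m≤n+m _ (g x))

  module _ {P Q : Pred A 0ℓ} (P? : Decidable P) (Q? : Decidable Q) where

    count-mono : (∀ {x} → P x → Q x) → (xs : List A) → count P? xs ≤ count Q? xs
    count-mono P⇒Q [] = z≤n
    count-mono P⇒Q (x ∷ xs) with P? x | Q? x
    ... | yes _  | yes _ = s≤s (count-mono P⇒Q xs)
    ... | yes px | no ¬q = contradiction (P⇒Q px) ¬q
    ... | no _   | yes _ = m≤n⇒m≤1+n (count-mono P⇒Q xs)
    ... | no _   | no _  = count-mono P⇒Q xs

  module _ {P Q R : Pred A 0ℓ} (P? : Decidable P) (Q? : Decidable Q) (R? : Decidable R) where

    count-≤-+ : (∀ {x} → P x → Q x ⊎ R x) → (xs : List A) → count P? xs ≤ count Q? xs + count R? xs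
    count-≤-+ P⇒Q∪R [] = z≤n
    count-≤-+ P⇒Q∪R (x ∷ xs) with P? x | Q? x | R? x
    ... | yes _  | yes _ | yes _ = s≤s (≤-trans (count-≤-+ P⇒Q∪R xs) (+-monoʳ-≤ _ (n≤1+n _)))
    ... | yes _  | yes _ | no _  = s≤s (count-≤-+ P⇒Q∪R xs)
    ... | yes _  | no _  | yes _ = ≤-trans (s≤s (count-≤-+ P⇒Q∪R xs)) (≤-reflexive (sym (+-suc _ _)))
    ... | yes px | no ¬q | no ¬r = ⊥-elim ([ ¬q , ¬r ]′ (P⇒Q∪R px))
    ... | no _   | yes _ | yes _ = m≤n⇒m≤1+n (≤-trans (count-≤-+ P⇒Q∪R xs) (+-monoʳ-≤ _ (n≤1+n _)))
    ... | no _   | yes _ | no _  = m≤n⇒m≤1+n (count-≤-+ P⇒Q∪R xs)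
    ... | no _   | no _  | yes _ = ≤-trans (count-≤-+ P⇒Q∪R xs) (+-monoʳ-≤ _ (n≤1+n _))
    ... | no _   | no _  | no _  = count-≤-+ P⇒Q∪R xs

  module _ {Q R : Pred A 0ℓ} (Q? : Decidable Q) (R? : Decidable R) where

    length-≤-count-+ : (∀ {x} → ¬ Q x → R x) → (xs : List A) → length xs ≤ count Q? xs + count R? xs
    length-≤-count-+ ¬Q⇒R xs = begin
      length xs            ≡⟨ count-all U? (All.universal _ xs) ⟨
      count U? xs          ≤⟨ count-≤-+ U? Q? R? Q∪R xs ⟩
      count Q? xs + count R? xs ∎
      where
        open ≤-Reasoning
        Q∪R : ∀ {x} → U x → Q x ⊎ R x
        Q∪R {x} _ with Q? x
        ... | yes qx = inj₁ qx
        ... | no ¬qx = inj₂ (¬Q⇒R ¬qx)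

module _ {A B : Set} {P : Pred B 0ℓ} (P? : Decidable P) where

  count-map : (f : A → B) (xs : List A) → count P? (map f xs) ≡ count (P? ∘ f) xs
  count-map f [] = refl
  count-map f (x ∷ xs) with P? (f x)
  ... | yes _ = cong suc (count-map f xs)
  ... | no _  = count-map f xs

  count-concatMap : (f : A → List B) (xs : List A) → count P? (concatMap f xs) ≡ sum (map (count P? ∘ f) xs)
  count-concatMap f [] = refl
  count-concatMap f (x ∷ xs) = trans (count-++ P? (f x) _) (cong (count P? (f x) +_) (count-concatMap f xs))

length-concatMap : {A B : Set} (f : A → List B) (xs : List A) → length (concatMap f xs) ≡ sum (map (length ∘ f) xs)
length-concatMap f [] = refl
length-concatMap f (x ∷ xs) = trans (length-++ (f x)) (cong (length (f x) +_) (length-concatMap f xs))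

sum-map-const : {A : Set} (g : A → ℕ) (c : ℕ) (xs : List A) → (∀ {x} → x ∈ xs → g x ≡ c) →
                sum (map g xs) ≡ length xs * c
sum-map-const g c [] h = refl
sum-map-const g c (x ∷ xs) h = cong₂ _+_ (h (here refl)) (sum-map-const g c xs (h ∘ there))

Unique-⊆-length : {A : Set} {xs ys : List A} → Unique xs → xs ⊆ ys → length xs ≤ length ys
Unique-⊆-length {xs = []} _ _ = z≤n
Unique-⊆-length {xs = x ∷ xs} (x∉xs ∷ u) xs⊆ys with ∈-∃++ (xs⊆ys (here refl))
... | ys₁ , ys₂ , refl = begin
  suc (length xs)           ≤⟨ s≤s (Unique-⊆-length u (λ z∈xs → ∈-delete (xs⊆ys (there z∈xs))
                                                                     (All.lookup x∉xs z∈xs))) ⟩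
  suc (length (ys₁ ++ ys₂)) ≡⟨ ↭-length (shift x ys₁ ys₂) ⟨
  length (ys₁ ++ x ∷ ys₂)   ∎
  where
    open ≤-Reasoning
    ∈-delete : ∀ {z} → z ∈ ys₁ ++ x ∷ ys₂ → x ≢ z → z ∈ ys₁ ++ ys₂
    ∈-delete z∈ x≢z with ∈-++⁻ ys₁ z∈
    ... | inj₁ z∈ys₁         = ∈-++⁺ˡ z∈ys₁
    ... | inj₂ (here z≡x)    = ⊥-elim (x≢z (sym z≡x))
    ... | inj₂ (there z∈ys₂) = ∈-++⁺ʳ ys₁ z∈ys₂

-- Ordered selections versus subsets

module _ {A : Set} where

  inserts : A → List A → List (List A)
  inserts x [] = [ [ x ] ]
  inserts x (y ∷ ys) = (x ∷ y ∷ ys) ∷ map (y ∷_) (inserts x ys)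

  length-inserts : (x : A) (ys : List A) → length (inserts x ys) ≡ suc (length ys)
  length-inserts x [] = refl
  length-inserts x (y ∷ ys) = cong suc (trans (length-map _ (inserts x ys)) (length-inserts x ys))

  inserts-↭ : (x : A) (ys : List A) → All (_↭ x ∷ ys) (inserts x ys)
  inserts-↭ x [] = ↭-refl ∷ []
  inserts-↭ x (y ∷ ys) =
    ↭-refl ∷ All.map⁺ (All.map (λ p → ↭-trans (↭-prep y p) (↭-swap y x ↭-refl)) (inserts-↭ x ys))

  ∈-inserts : (x : A) (ys zs : List A) → ys ++ x ∷ zs ∈ inserts x (ys ++ zs)
  ∈-inserts x [] [] = here refl
  ∈-inserts x [] (z ∷ zs) = here refl
  ∈-inserts x (y ∷ ys) zs = there (∈-map⁺ (y ∷_) (∈-inserts x ys zs))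

  arrangements : ℕ → List A → List (List A)
  arrangements zero xs = [ [] ]
  arrangements (suc k) [] = []
  arrangements (suc k) (x ∷ xs) = concatMap (inserts x) (arrangements k xs) ++ arrangements (suc k) xs

  arrangements-length : (k : ℕ) (xs : List A) → All (λ ys → length ys ≡ k) (arrangements k xs)
  arrangements-length zero xs = refl ∷ []
  arrangements-length (suc k) [] = []
  arrangements-length (suc k) (x ∷ xs) =
    All.++⁺ (All.concat⁺ (All.map⁺ (All.map inserts-length (arrangements-length k xs))))
            (arrangements-length (suc k) xs)
    where
      inserts-length : ∀ {ys} → length ys ≡ k → All (λ zs → length zs ≡ suc k) (inserts x ys)
      inserts-length {ys} len = All.map (λ p → trans (↭-length p) (cong suc len)) (inserts-↭ x ys)

  module _ {P : Pred (List A) 0ℓ} (P? : Decidable P) (resp : P Respects _↭_) (x : A) (k : ℕ) where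

    sum-count-inserts : (yss : List (List A)) → All (λ ys → length ys ≡ k) yss →
                        sum (map (count P? ∘ inserts x) yss) ≡ suc k * count (P? ∘ (x ∷_)) yss
    sum-count-inserts [] [] = sym (*-zeroʳ (suc k))
    sum-count-inserts (ys ∷ yss) (len ∷ lens) with P? (x ∷ ys)
    ... | yes p = begin
      count P? (inserts x ys) + sum (map (count P? ∘ inserts x) yss)
        ≡⟨ cong₂ _+_ (count-all P? (All.map (λ q → resp (↭-sym q) p) (inserts-↭ x ys)))
                     (sum-count-inserts yss lens) ⟩
      length (inserts x ys) + suc k * count (P? ∘ (x ∷_)) yss
        ≡⟨ cong (_+ suc k * count (P? ∘ (x ∷_)) yss) (trans (length-inserts x ys) (cong suc len)) ⟩
      suc k + suc k * count (P? ∘ (x ∷_)) yss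
        ≡⟨ *-suc (suc k) _ ⟨
      suc k * suc (count (P? ∘ (x ∷_)) yss) ∎
      where open ≡-Reasoning
    ... | no ¬p =
      cong₂ _+_ (count-none P? (All.map (λ q p → ¬p (resp q p)) (inserts-↭ x ys))) (sum-count-inserts yss lens)

count-arrangements : {A : Set} {P : Pred (List A) 0ℓ} (P? : Decidable P) → P Respects _↭_ →
                     (k : ℕ) (xs : List A) → count P? (arrangements k xs) ≡ k ! * count P? (combinations k xs)
count-arrangements P? resp zero xs = sym (+-identityʳ _)
count-arrangements P? resp (suc k) [] = sym (*-zeroʳ (suc k !))
count-arrangements {P = P} P? resp (suc k) (x ∷ xs) = begin
  count P? (concatMap (inserts x) (arrangements k xs) ++ arrangements (suc k) xs)
    ≡⟨ count-++ P? (concatMap (inserts x) (arrangements k xs)) _ ⟩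
  count P? (concatMap (inserts x) (arrangements k xs)) + count P? (arrangements (suc k) xs)
    ≡⟨ cong₂ _+_ (trans (count-concatMap P? (inserts x) (arrangements k xs))
                        (sum-count-inserts P? resp x k (arrangements k xs) (arrangements-length k xs)))
                 (count-arrangements P? resp (suc k) xs) ⟩
  suc k * count Px? (arrangements k xs) + suc k ! * b
    ≡⟨ cong (λ z → suc k * z + suc k ! * b) (count-arrangements Px? (resp ∘ ↭-prep x) k xs) ⟩
  suc k * (k ! * a) + suc k ! * b
    ≡⟨ cong (_+ suc k ! * b) (*-assoc (suc k) (k !) a) ⟨
  suc k ! * a + suc k ! * b
    ≡⟨ *-distribˡ-+ (suc k !) a b ⟨
  suc k ! * (a + b)
    ≡⟨ cong (λ z → suc k ! * (z + b)) (count-map P? (x ∷_) (combinations k xs)) ⟨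
  suc k ! * (count P? (map (x ∷_) (combinations k xs)) + b)
    ≡⟨ cong (suc k ! *_) (count-++ P? (map (x ∷_) (combinations k xs)) _) ⟨
  suc k ! * count P? (map (x ∷_) (combinations k xs) ++ combinations (suc k) xs) ∎
  where
    open ≡-Reasoning
    Px? : Decidable (P ∘ (x ∷_))
    Px? = P? ∘ (x ∷_)
    a = count Px? (combinations k xs)
    b = count P? (combinations (suc k) xs)

module _ {A : Set} where

  tuples : List A → ℕ → List (List A)
  tuples xs zero = [ [] ]
  tuples xs (suc k) = cartesianProductWith (λ ys x → x ∷ ys) (tuples xs k) xs

  ∈-tuples⁻ : (xs : List A) (k : ℕ) {ys : List A} → ys ∈ tuples xs k → length ys ≡ k × ys ⊆ xs
  ∈-tuples⁻ xs zero (here refl) = refl , λ ()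
  ∈-tuples⁻ xs (suc k) ys∈ with ∈-cartesianProductWith⁻ _ (tuples xs k) xs ys∈
  ... | zs , x , zs∈ , x∈xs , refl with len , zs⊆xs ← ∈-tuples⁻ xs k zs∈ =
    cong suc len , λ { (here refl) → x∈xs ; (there y∈zs) → zs⊆xs y∈zs }

  Unique-tuples : {xs : List A} → Unique xs → (k : ℕ) → Unique (tuples xs k)
  Unique-tuples u zero = [] ∷ []
  Unique-tuples u (suc k) =
    Unique.cartesianProductWith⁺ (λ ys x → x ∷ ys) (Product.swap ∘ ∷-injective) (Unique-tuples u k) u

  module _ {P : Pred (List A) 0ℓ} (P? : Decidable P) where

    count-tuples-suc : (xs : List A) (k : ℕ) →
                       count P? (tuples xs (suc k)) ≡ sum (map (λ ys → count (λ x → P? (x ∷ ys)) xs) (tuples xs k))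
    count-tuples-suc xs k = go (tuples xs k)
      where
        go : (yss : List (List A)) → count P? (cartesianProductWith (λ ys x → x ∷ ys) yss xs)
                                     ≡ sum (map (λ ys → count (λ x → P? (x ∷ ys)) xs) yss)
        go [] = refl
        go (ys ∷ yss) = trans (count-++ P? (map (_∷ ys) xs) _) (cong₂ _+_ (count-map P? (_∷ ys) xs) (go yss))

module _ {A : Set} (_≟_ : DecidableEquality A) where

  open import Data.List.Membership.DecPropositional _≟_ using (_∈?_)

  ∈-arrangements : (k : ℕ) (xs ys : List A) → Unique ys → length ys ≡ k → ys ⊆ xs → ys ∈ arrangements k xs
  ∈-arrangements zero xs [] _ _ _ = here refl
  ∈-arrangements (suc k) [] (y ∷ ys) _ _ ys⊆ with () ← ys⊆ (here refl)
  ∈-arrangements (suc k) (x ∷ xs) ys u len ys⊆ with x ∈? ys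
  ... | no x∉ys = ∈-++⁺ʳ _ (∈-arrangements (suc k) xs ys u len (λ y∈ys → ∈-tail y∈ys (ys⊆ y∈ys)))
    where
      ∈-tail : ∀ {y} → y ∈ ys → y ∈ x ∷ xs → y ∈ xs
      ∈-tail y∈ys (here refl) = ⊥-elim (x∉ys y∈ys)
      ∈-tail _ (there y∈xs) = y∈xs
  ... | yes x∈ys with ys₁ , ys₂ , refl ← ∈-∃++ x∈ys =
    ∈-++⁺ˡ (∈-concatMap⁺ (inserts x) (lose rest∈arrangements (∈-inserts x ys₁ ys₂)))
    where
      x∷rest↭ys : x ∷ ys₁ ++ ys₂ ↭ ys₁ ++ x ∷ ys₂
      x∷rest↭ys = ↭-sym (shift x ys₁ ys₂)
      u′ : Unique (x ∷ ys₁ ++ ys₂)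
      u′ = Unique-resp-↭ (setoid A) (↭⇒↭ₛ (↭-sym x∷rest↭ys)) u
      rest⊆xs : ys₁ ++ ys₂ ⊆ xs
      rest⊆xs {y} y∈rest with ys⊆ (∈-resp-↭ x∷rest↭ys (there y∈rest))
      ... | here refl = ⊥-elim (All.lookup (AllPairs.head u′) y∈rest refl)
      ... | there y∈xs = y∈xs
      rest∈arrangements : ys₁ ++ ys₂ ∈ arrangements k xs
      rest∈arrangements = ∈-arrangements k xs (ys₁ ++ ys₂) (AllPairs.tail u′)
                            (suc-injective (trans (↭-length x∷rest↭ys) len)) rest⊆xs

  count-tuples-≤-combinations : {P : Pred (List A) 0ℓ} (P? : Decidable P) → P Respects _↭_ →
                                (∀ {ys} → P ys → Unique ys) → {xs : List A} → Unique xs →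
                                (k : ℕ) → count P? (tuples xs k) ≤ k ! * count P? (combinations k xs)
  count-tuples-≤-combinations P? resp P⇒Unique {xs} u k = begin
    count P? (tuples xs k)        ≤⟨ Unique-⊆-length (Unique.filter⁺ P? (Unique-tuples u k)) P-tuple∈arrangements ⟩
    count P? (arrangements k xs)  ≡⟨ count-arrangements P? resp k xs ⟩
    k ! * count P? (combinations k xs) ∎
    where
      open ≤-Reasoning
      P-tuple∈arrangements : filter P? (tuples xs k) ⊆ filter P? (arrangements k xs)
      P-tuple∈arrangements ys∈ with ys∈tuples , p ← ∈-filter⁻ P? ys∈
                               with len , ys⊆xs ← ∈-tuples⁻ xs k ys∈tuples =
        ∈-filter⁺ P? (∈-arrangements k xs _ (P⇒Unique p) len ys⊆xs) p

-- Colourings by sums of vertex labels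

choose₂ : ℕ → ℕ
choose₂ zero = 0
choose₂ (suc n) = n + choose₂ n

choose₂≡C2 : ∀ n → choose₂ n ≡ n C 2
choose₂≡C2 zero = refl
choose₂≡C2 (suc n) = trans (cong₂ _+_ (sym (nC1≡n n)) (choose₂≡C2 n)) (nCk+nC[k+1]≡[n+1]C[k+1] n 1)

module _ {A : Set} where

  length-pairs : (xs : List A) → length (pairs xs) ≡ choose₂ (length xs)
  length-pairs [] = refl
  length-pairs (x ∷ xs) = trans (length-++ (map (x ,_) xs)) (cong₂ _+_ (length-map _ xs) (length-pairs xs))

  pairs-⊆ : {p q : A} (xs : List A) → (p , q) ∈ pairs xs → p ∈ xs × q ∈ xs
  pairs-⊆ (x ∷ xs) pq∈ with ∈-++⁻ (map (x ,_) xs) pq∈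
  ... | inj₁ pq∈xxs with _ , q∈xs , refl ← ∈-map⁻ _ pq∈xxs = here refl , there q∈xs
  ... | inj₂ pq∈pairs with p∈xs , q∈xs ← pairs-⊆ xs pq∈pairs = there p∈xs , there q∈xs

  picks : List A → List (A × List A)
  picks [] = []
  picks (x ∷ xs) = (x , xs) ∷ map (Product.map₂ (x ∷_)) (picks xs)

  length-picks : (xs : List A) → length (picks xs) ≡ length xs
  length-picks [] = refl
  length-picks (x ∷ xs) = cong suc (trans (length-map _ (picks xs)) (length-picks xs))

  picks-↭ : (xs : List A) → All (λ (y , ys) → xs ↭ y ∷ ys) (picks xs)
  picks-↭ [] = []
  picks-↭ (x ∷ xs) =
    ↭-refl ∷ All.map⁺ (All.map (λ p → ↭-trans (↭-prep x p) (↭-swap x _ ↭-refl)) (picks-↭ xs))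

  ∈-picks : {y : A} (xs : List A) → y ∈ xs → ∃[ ys ] (y , ys) ∈ picks xs
  ∈-picks (x ∷ xs) (here refl) = xs , here refl
  ∈-picks (x ∷ xs) (there y∈xs) with ys , y,ys∈ ← ∈-picks xs y∈xs = x ∷ ys , there (∈-map⁺ _ y,ys∈)

  module _ (_≟_ : DecidableEquality A) where

    pairs-avoiding : {y p q : A} (xs : List A) → y ∈ xs → (p , q) ∈ pairs xs →
                     y ≡ p ⊎ y ≡ q ⊎ ∃[ ys ] ((y , ys) ∈ picks xs × (p , q) ∈ pairs ys)
    pairs-avoiding (x ∷ xs) y∈ pq∈ with ∈-++⁻ (map (x ,_) xs) pq∈
    pairs-avoiding (x ∷ xs) (here refl) pq∈ | inj₁ pq∈xxs with _ , _ , refl ← ∈-map⁻ _ pq∈xxs = inj₁ refl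
    pairs-avoiding (x ∷ xs) (here refl) pq∈ | inj₂ pq∈pairs = inj₂ (inj₂ (xs , here refl , pq∈pairs))
    pairs-avoiding {y} (x ∷ xs) (there y∈xs) pq∈ | inj₁ pq∈xxs
      with q , q∈xs , refl ← ∈-map⁻ _ pq∈xxs with y ≟ q
    ... | yes y≡q = inj₂ (inj₁ y≡q)
    ... | no y≢q with ys , y,ys∈ ← ∈-picks xs y∈xs =
      inj₂ (inj₂ (x ∷ ys , there (∈-map⁺ _ y,ys∈) , ∈-++⁺ˡ (∈-map⁺ _ q∈ys)))
      where
        q∈ys : q ∈ ys
        q∈ys with ∈-resp-↭ (All.lookup (picks-↭ xs) y,ys∈) q∈xs
        ... | here q≡y = ⊥-elim (y≢q (sym q≡y))
        ... | there q∈ys = q∈ys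
    pairs-avoiding (x ∷ xs) (there y∈xs) pq∈ | inj₂ pq∈pairs with pairs-avoiding xs y∈xs pq∈pairs
    ... | inj₁ y≡p = inj₁ y≡p
    ... | inj₂ (inj₁ y≡q) = inj₂ (inj₁ y≡q)
    ... | inj₂ (inj₂ (ys , y,ys∈ , pq∈ys)) =
      inj₂ (inj₂ (x ∷ ys , there (∈-map⁺ _ y,ys∈) , ∈-++⁺ʳ _ pq∈ys))

forbiddenCount : ℕ → ℕ
forbiddenCount k = k + k * choose₂ (pred k)

greedyCount : ℕ → ℕ → ℕ
greedyCount r zero = 1
greedyCount r (suc k) = greedyCount r k * (r ∸ forbiddenCount k)

module SumColouring {A L : Set} (_≟A_ : DecidableEquality A) (_≟L_ : DecidableEquality L)
                    (_⊕_ _⊖_ : L → L → L) (⊕-comm : ∀ a b → a ⊕ b ≡ b ⊕ a)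
                    (⊕-⊖ : ∀ a b → (a ⊕ b) ⊖ b ≡ a)
                    (label : A → L) where

  colour : A → A → L
  colour x y = label x ⊕ label y

  -- Written as Defs.edgeColours is, so that the two agree definitionally.
  colours : List A → List L
  colours S = map (λ e → colour (proj₁ e) (proj₂ e)) (pairs S)

  StronglyRainbow : List A → Set
  StronglyRainbow S = Unique (map label S) × Unique (colours S)

  stronglyRainbow? : Decidable StronglyRainbow
  stronglyRainbow? S = UniqueDec.unique? _≟L_ (map label S) ×-dec UniqueDec.unique? _≟L_ (colours S)

  ⊕-cancelʳ : ∀ a b c → a ⊕ c ≡ b ⊕ c → a ≡ b
  ⊕-cancelʳ a b c eq = trans (sym (⊕-⊖ a c)) (trans (cong (_⊖ c) eq) (⊕-⊖ b c))

  ⊕-cancelˡ : ∀ c a b → c ⊕ a ≡ c ⊕ b → a ≡ b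
  ⊕-cancelˡ c a b eq = ⊕-cancelʳ a b c (trans (⊕-comm a c) (trans eq (⊕-comm c b)))

  colours-∷ : (x : A) (S : List A) → colours (x ∷ S) ≡ map (colour x) S ++ colours S
  colours-∷ x S = trans (map-++ _ (map (x ,_) S) (pairs S)) (cong (_++ colours S) (sym (map-∘ S)))

  -- The labels of x for which the edge xy has the colour of an edge pq of R.
  clashes : A → List A → List L
  clashes y R = map (λ (p , q) → (label p ⊕ label q) ⊖ label y) (pairs R)

  forbidden : List A → List L
  forbidden T = map label T ++ concatMap (λ (y , R) → clashes y R) (picks T)

  length-forbidden : (T : List A) → length (forbidden T) ≡ forbiddenCount (length T)
  length-forbidden T = begin
    length (forbidden T)
      ≡⟨ length-++ (map label T) ⟩
    length (map label T) + length (concatMap _ (picks T))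
      ≡⟨ cong₂ _+_ (length-map label T) (length-concatMap _ (picks T)) ⟩
    length T + sum (map (λ (y , R) → length (clashes y R)) (picks T))
      ≡⟨ cong (length T +_) (sum-map-const _ (choose₂ (pred (length T))) (picks T) length-clashes) ⟩
    length T + length (picks T) * choose₂ (pred (length T))
      ≡⟨ cong (λ l → length T + l * choose₂ (pred (length T))) (length-picks T) ⟩
    forbiddenCount (length T) ∎
    where
      open ≡-Reasoning
      length-clashes : ∀ {yR} → yR ∈ picks T → length (clashes (proj₁ yR) (proj₂ yR)) ≡ choose₂ (pred (length T))
      length-clashes {y , R} yR∈ = trans (length-map _ (pairs R))
        (trans (length-pairs R) (cong (choose₂ ∘ pred) (↭-length (↭-sym (All.lookup (picks-↭ T) yR∈)))))

  extend-stronglyRainbow : {x : A} {T : List A} → StronglyRainbow T → label x ∉ forbidden T → StronglyRainbow (x ∷ T)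
  extend-stronglyRainbow {x} {T} (labels-unique , colours-unique) x-allowed =
    ¬Any⇒All¬ (map label T) (x-allowed ∘ ∈-++⁺ˡ) ∷ labels-unique ,
    subst Unique (sym (colours-∷ x T)) (Unique.++⁺ new-unique colours-unique new-disjoint)
    where
      new-unique : Unique (map (colour x) T)
      new-unique = subst Unique (sym (map-∘ T)) (Unique.map⁺ (⊕-cancelˡ (label x) _ _) labels-unique)
      label-of-T : ∀ {z} → z ∈ T → label x ≢ label z
      label-of-T z∈T eq = x-allowed (∈-++⁺ˡ (subst (_∈ map label T) (sym eq) (∈-map⁺ label z∈T)))
      new-disjoint : Disjoint (map (colour x) T) (colours T)
      new-disjoint (c∈new , c∈old)
        with y , y∈T , refl ← ∈-map⁻ _ c∈new | (p , q) , pq∈ , eq ← ∈-map⁻ _ c∈old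
        with pairs-avoiding _≟A_ T y∈T pq∈
      ... | inj₁ refl = label-of-T (proj₂ (pairs-⊆ T pq∈)) (⊕-cancelʳ _ _ (label y) (trans eq (⊕-comm _ _)))
      ... | inj₂ (inj₁ refl) = label-of-T (proj₁ (pairs-⊆ T pq∈)) (⊕-cancelʳ _ _ (label y) eq)
      ... | inj₂ (inj₂ (R , yR∈ , pq∈R)) =
        x-allowed (∈-++⁺ʳ (map label T) (∈-concatMap⁺ _ (lose yR∈ x-clashes)))
        where
          x-clashes : label x ∈ clashes y R
          x-clashes = subst (_∈ clashes y R) (trans (cong (_⊖ label y) (sym eq)) (⊕-⊖ (label x) (label y)))
                            (∈-map⁺ (λ (p , q) → (label p ⊕ label q) ⊖ label y) pq∈R)

  colours-↭ : {S S′ : List A} → S ↭ S′ → colours S ↭ colours S′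
  colours-↭ ↭.refl = ↭-refl
  colours-↭ (↭.trans p q) = ↭-trans (colours-↭ p) (colours-↭ q)
  colours-↭ {x ∷ S} {x ∷ S′} (↭.prep x p) =
    subst₂ _↭_ (sym (colours-∷ x S)) (sym (colours-∷ x S′)) (++⁺ (↭-map⁺ (colour x) p) (colours-↭ p))
  colours-↭ {x ∷ y ∷ S} {y ∷ x ∷ S′} (↭.swap x y p) = subst₂ _↭_ (sym (expand x y S)) (sym (expand y x S′))
    (subst (λ c → colour x y ∷ rest ↭ c ∷ rest′) (⊕-comm (label x) (label y)) (↭-prep (colour x y) rest↭rest′))
    where
      expand : ∀ x y S → colours (x ∷ y ∷ S) ≡ colour x y ∷ map (colour x) S ++ map (colour y) S ++ colours S
      expand x y S = trans (colours-∷ x (y ∷ S)) (cong (map (colour x) (y ∷ S) ++_) (colours-∷ y S))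
      rest = map (colour x) S ++ map (colour y) S ++ colours S
      rest′ = map (colour y) S′ ++ map (colour x) S′ ++ colours S′
      rest↭rest′ : rest ↭ rest′
      rest↭rest′ = ↭-trans (shifts (map (colour x) S) (map (colour y) S))
                           (++⁺ (↭-map⁺ (colour y) p) (++⁺ (↭-map⁺ (colour x) p) (colours-↭ p)))

  stronglyRainbow-resp-↭ : StronglyRainbow Respects _↭_
  stronglyRainbow-resp-↭ p (labels-unique , colours-unique) =
    Unique-resp-↭ (setoid L) (↭⇒↭ₛ (↭-map⁺ label p)) labels-unique ,
    Unique-resp-↭ (setoid L) (↭⇒↭ₛ (colours-↭ p)) colours-unique

  module Counting (xs : List A) (xs-unique : Unique xs) (r m : ℕ) (length-xs : length xs ≡ r * m)
                  (fibre-≤ : ∀ a → count (λ v → label v ≟L a) xs ≤ m) where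

    open import Data.List.Membership.DecPropositional _≟L_ using (_∈?_)

    count-label∈ : (ℓs : List L) → count (λ v → label v ∈? ℓs) xs ≤ length ℓs * m
    count-label∈ [] = ≤-reflexive (count-none (λ v → label v ∈? []) (All.universal (λ _ ()) xs))
    count-label∈ (a ∷ ℓs) = ≤-trans
      (count-≤-+ (λ v → label v ∈? (a ∷ ℓs)) (λ v → label v ≟L a) (λ v → label v ∈? ℓs) ∈-∷⁻ xs)
      (+-mono-≤ (fibre-≤ a) (count-label∈ ℓs))
      where
        ∈-∷⁻ : ∀ {ℓ} → ℓ ∈ a ∷ ℓs → ℓ ≡ a ⊎ ℓ ∈ ℓs
        ∈-∷⁻ (here ℓ≡a) = inj₁ ℓ≡a
        ∈-∷⁻ (there ℓ∈ℓs) = inj₂ ℓ∈ℓs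

    count-extensions : {T : List A} → StronglyRainbow T →
                       (r ∸ forbiddenCount (length T)) * m ≤ count (λ x → stronglyRainbow? (x ∷ T)) xs
    count-extensions {T} T-sr = begin
      (r ∸ forbiddenCount (length T)) * m    ≡⟨ *-distribʳ-∸ m r (forbiddenCount (length T)) ⟩
      r * m ∸ forbiddenCount (length T) * m  ≡⟨ cong₂ (λ n f → n ∸ f * m) (sym length-xs) (sym (length-forbidden T)) ⟩
      length xs ∸ excluded                   ≤⟨ ∸-monoˡ-≤ excluded length-xs≤ ⟩
      extensions + excluded ∸ excluded       ≡⟨ m+n∸n≡m extensions excluded ⟩
      extensions                             ∎
      where
        open ≤-Reasoning
        extensions = count (λ x → stronglyRainbow? (x ∷ T)) xs
        excluded = length (forbidden T) * m
        allowed-or-forbidden : ∀ {x} → ¬ StronglyRainbow (x ∷ T) → label x ∈ forbidden T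
        allowed-or-forbidden {x} ¬sr with label x ∈? forbidden T
        ... | yes x-forbidden = x-forbidden
        ... | no x-allowed = ⊥-elim (¬sr (extend-stronglyRainbow T-sr x-allowed))
        length-xs≤ : length xs ≤ extensions + excluded
        length-xs≤ = ≤-trans (length-≤-count-+ (λ x → stronglyRainbow? (x ∷ T)) (λ x → label x ∈? forbidden T)
                                               allowed-or-forbidden xs)
                             (+-monoʳ-≤ extensions (count-label∈ (forbidden T)))

    count-tuples : (k : ℕ) → greedyCount r k * m ^ k ≤ count stronglyRainbow? (tuples xs k)
    count-tuples zero = ≤-reflexive (sym (count-all stronglyRainbow? (([] , []) ∷ [])))
    count-tuples (suc k) = begin
      greedyCount r k * (r ∸ forbiddenCount k) * (m * m ^ k)
        ≡⟨ rearrange (greedyCount r k) (r ∸ forbiddenCount k) m (m ^ k) ⟩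
      greedyCount r k * m ^ k * ((r ∸ forbiddenCount k) * m)
        ≤⟨ *-monoˡ-≤ _ (count-tuples k) ⟩
      count stronglyRainbow? (tuples xs k) * ((r ∸ forbiddenCount k) * m)
        ≤⟨ count-*-≤-sum stronglyRainbow? _ _ (tuples xs k) extensions ⟩
      sum (map (λ T → count (λ x → stronglyRainbow? (x ∷ T)) xs) (tuples xs k))
        ≡⟨ count-tuples-suc stronglyRainbow? xs k ⟨
      count stronglyRainbow? (tuples xs (suc k)) ∎
      where
        open ≤-Reasoning
        rearrange : ∀ a b c d → a * b * (c * d) ≡ a * d * (b * c)
        rearrange = solve-∀
        extensions : ∀ {T} → T ∈ tuples xs k → StronglyRainbow T →
                     (r ∸ forbiddenCount k) * m ≤ count (λ x → stronglyRainbow? (x ∷ T)) xs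
        extensions T∈ T-sr =
          subst (λ l → (r ∸ forbiddenCount l) * m ≤ _) (proj₁ (∈-tuples⁻ xs k T∈)) (count-extensions T-sr)

    count-combinations : (k : ℕ) → greedyCount r k * m ^ k ≤ k ! * count stronglyRainbow? (combinations k xs)
    count-combinations k = ≤-trans (count-tuples k)
      (count-tuples-≤-combinations _≟A_ stronglyRainbow? stronglyRainbow-resp-↭ (Unique.map⁻ ∘ proj₁) xs-unique k)

-- Numerical estimates

choose₂-+ : ∀ a b → choose₂ (a + b) ≡ choose₂ a + a * b + choose₂ b
choose₂-+ zero b = refl
choose₂-+ (suc a) b = trans (cong ((a + b) +_) (choose₂-+ a b)) (regroup a b (choose₂ a) (choose₂ b))
  where
    regroup : ∀ a b x y → (a + b) + (x + a * b + y) ≡ (a + x) + (b + a * b) + y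
    regroup = solve-∀

forbiddenTotal : ℕ → ℕ
forbiddenTotal zero = 0
forbiddenTotal (suc k) = forbiddenTotal k + forbiddenCount k

forbiddenCount≤forbiddenTotal : ∀ {j k} → j < k → forbiddenCount j ≤ forbiddenTotal k
forbiddenCount≤forbiddenTotal {j} {suc k} j<1+k with m<1+n⇒m<n∨m≡n j<1+k
... | inj₁ j<k = ≤-trans (forbiddenCount≤forbiddenTotal j<k) (m≤m+n (forbiddenTotal k) (forbiddenCount k))
... | inj₂ refl = m≤n+m (forbiddenCount j) (forbiddenTotal j)

forbiddenTotal<choose₂[C2] : ∀ {t} → 4 ≤ t → forbiddenTotal t < choose₂ (t C 2)
forbiddenTotal<choose₂[C2] {t} 4≤t = subst (λ c → forbiddenTotal t < choose₂ c) (choose₂≡C2 t)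
  (subst (λ t → forbiddenTotal t < choose₂ (choose₂ t)) (m+[n∸m]≡n 4≤t) (from4 (t ∸ 4)))
  where
    from4 : ∀ u → forbiddenTotal (4 + u) < choose₂ (choose₂ (4 + u))
    from4 zero = m≤m+n 10 5
    from4 (suc u) = begin-strict
      forbiddenTotal s + (s + s * choose₂ (pred s))
        <⟨ +-mono-<-≤ (from4 u) (+-mono-≤ s≤choose₂s (*-monoʳ-≤ s (m≤n+m (choose₂ (pred s)) (pred s)))) ⟩
      choose₂ (choose₂ s) + (choose₂ s + s * choose₂ s)
        ≡⟨ +-comm (choose₂ (choose₂ s)) _ ⟩
      choose₂ s + s * choose₂ s + choose₂ (choose₂ s)
        ≡⟨ choose₂-+ s (choose₂ s) ⟨
      choose₂ (s + choose₂ s) ∎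
      where
        open ≤-Reasoning
        s = 4 + u
        s≤choose₂s : s ≤ choose₂ s
        s≤choose₂s = ≤-trans (≤-reflexive (+-comm 1 (3 + u))) (+-monoʳ-≤ (3 + u) (m≤m+n 1 _))

greedyCount≤^ : ∀ r k → greedyCount r k ≤ r ^ k
greedyCount≤^ r zero = ≤-refl
greedyCount≤^ r (suc k) =
  ≤-trans (≤-reflexive (*-comm (greedyCount r k) _)) (*-mono-≤ (m∸n≤m r (forbiddenCount k)) (greedyCount≤^ r k))

-- Weierstrass' product inequality ∏ (1 - Fⱼ/r) ≥ 1 - Σ Fⱼ/r, multiplied through by r ^ (k + 1).
greedyCount-lower : ∀ r k → (∀ {j} → j < k → forbiddenCount j ≤ r) →
                    r ^ suc k ≤ greedyCount r k * r + forbiddenTotal k * r ^ k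
greedyCount-lower r zero _ = ≤-reflexive (e r)
  where
    e : ∀ r → r * 1 ≡ 1 * r + 0 * 1
    e = solve-∀
greedyCount-lower r (suc k) F≤r = begin
  r * (r * p)                            ≤⟨ *-monoʳ-≤ r (greedyCount-lower r k (F≤r ∘ m<n⇒m<1+n)) ⟩
  r * (q * r + b * p)                    ≡⟨ e₁ r q b p ⟩
  q * r * r + b * (r * p)                ≡⟨ cong (λ x → q * r * x + b * (r * p)) (m∸n+n≡m (F≤r (n<1+n k))) ⟨
  q * r * (d + f) + b * (r * p)          ≡⟨ e₂ q r d f (b * (r * p)) ⟩
  q * d * r + q * r * f + b * (r * p)    ≤⟨ +-monoˡ-≤ _ (+-monoʳ-≤ (q * d * r) (*-monoˡ-≤ f q*r≤r*p)) ⟩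
  q * d * r + r * p * f + b * (r * p)    ≡⟨ e₃ (q * d * r) (r * p) f b ⟩
  q * d * r + (b + f) * (r * p)          ∎
  where
    open ≤-Reasoning
    q = greedyCount r k
    b = forbiddenTotal k
    f = forbiddenCount k
    d = r ∸ f
    p = r ^ k
    q*r≤r*p : q * r ≤ r * p
    q*r≤r*p = ≤-trans (≤-reflexive (*-comm q r)) (*-monoʳ-≤ r (greedyCount≤^ r k))
    e₁ : ∀ r q b p → r * (q * r + b * p) ≡ q * r * r + b * (r * p)
    e₁ = solve-∀
    e₂ : ∀ q r d f x → q * r * (d + f) + x ≡ q * d * r + q * r * f + x
    e₂ = solve-∀
    e₃ : ∀ x y f b → x + y * f + b * y ≡ x + (b + f) * y
    e₃ = solve-∀

∸-*-≤ : ∀ r k x → (r ∸ k) * (r + (k + x)) ≤ r * (r + x)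
∸-*-≤ r k x with k ≤? r
... | no k≰r = ≤-trans (≤-reflexive (cong (_* (r + (k + x))) (m≤n⇒m∸n≡0 (<⇒≤ (≰⇒> k≰r))))) z≤n
... | yes k≤r = subst (λ r → (r ∸ k) * (r + (k + x)) ≤ r * (r + x)) (m+[n∸m]≡n k≤r) (split (r ∸ k))
  where
    split : ∀ d → (k + d ∸ k) * (k + d + (k + x)) ≤ (k + d) * (k + d + x)
    split d = begin
      (k + d ∸ k) * (k + d + (k + x))  ≡⟨ cong (_* (k + d + (k + x))) (m+n∸m≡n k d) ⟩
      d * (k + d + (k + x))            ≡⟨ e₁ k d x ⟩
      d * (k + d + x) + k * d          ≤⟨ +-monoʳ-≤ _ (*-monoʳ-≤ k (≤-trans (m≤n+m d k) (m≤m+n (k + d) x))) ⟩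
      d * (k + d + x) + k * (k + d + x) ≡⟨ e₂ k d x ⟩
      (k + d) * (k + d + x)            ∎
      where
        open ≤-Reasoning
        e₁ : ∀ k d x → d * (k + d + (k + x)) ≡ d * (k + d + x) + k * d
        e₁ = solve-∀
        e₂ : ∀ k d x → d * (k + d + x) + k * (k + d + x) ≡ (k + d) * (k + d + x)
        e₂ = solve-∀

P′-*-≤ : ∀ r k → (r P′ k) * (r + choose₂ k) ≤ r ^ suc k
P′-*-≤ r zero = ≤-reflexive (e r)
  where
    e : ∀ r → 1 * (r + 0) ≡ r * 1
    e = solve-∀
P′-*-≤ r (suc k) = begin
  (r ∸ k) * p * (r + (k + x))     ≡⟨ e₁ (r ∸ k) p (r + (k + x)) ⟩
  p * ((r ∸ k) * (r + (k + x)))   ≤⟨ *-monoʳ-≤ p (∸-*-≤ r k x) ⟩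
  p * (r * (r + x))               ≡⟨ e₂ p r (r + x) ⟩
  r * (p * (r + x))               ≤⟨ *-monoʳ-≤ r (P′-*-≤ r k) ⟩
  r * r ^ suc k                   ∎
  where
    open ≤-Reasoning
    p = r P′ k
    x = choose₂ k
    e₁ : ∀ a p y → a * p * y ≡ p * (a * y)
    e₁ = solve-∀
    e₂ : ∀ p r y → p * (r * y) ≡ r * (p * y)
    e₂ = solve-∀

C*!≤P′ : ∀ n k → (n C k) * k ! ≤ n P′ k
C*!≤P′ n k with k ≤? n
... | yes k≤n = ≤-trans (≤-reflexive (cong (_* k !) C≡P′/!)) (m/n*n≤m (n P′ k) (k !))
  where
    instance _ = k !≢0
    C≡P′/! : n C k ≡ (n P′ k) / k !
    C≡P′/! = trans (nCk≡nPk/k! k≤n) (cong (_/ k !) (trans (nPk≡n!/[n∸k]! k≤n) (sym (nP′k≡n!/[n∸k]! k≤n))))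
... | no k≰n = ≤-trans (≤-reflexive (cong (_* k !) (k>n⇒nCk≡0 (≰⇒> k≰n)))) z≤n

P′≤^ : ∀ n k → n P′ k ≤ n ^ k
P′≤^ n zero = ≤-refl
P′≤^ n (suc k) = *-mono-≤ (m∸n≤m n k) (P′≤^ n k)

*-^ : ∀ a b k → (a * b) ^ k ≡ a ^ k * b ^ k
*-^ a b zero = refl
*-^ a b (suc k) = trans (cong (a * b *_) (*-^ a b k)) (e a b (a ^ k) (b ^ k))
  where
    e : ∀ a b x y → a * b * (x * y) ≡ a * x * (b * y)
    e = solve-∀

C-pos : ∀ {n k} → k ≤ n → 0 < n C k
C-pos {n} {zero} _ = z<s
C-pos {suc n} {suc k} (s≤s k≤n) =
  <-≤-trans (C-pos k≤n) (≤-trans (m≤m+n (n C k) (n C suc k)) (≤-reflexive (nCk+nC[k+1]≡[n+1]C[k+1] n k)))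

-- In fractions: (r C e) e! / r ^ e + 1 / D ≤ greedyCount r k / r ^ k.
greedyCount-gap : ∀ r k e → let S = choose₂ e; D = r * (r + S) in
                  forbiddenTotal k < S → forbiddenTotal k ≤ r → suc (forbiddenTotal k * S) ≤ r →
                  r ^ k * ((r C e) * e ! * D + r ^ e) ≤ greedyCount r k * (r ^ e * D)
greedyCount-gap r k e B<S B≤r BS<r = begin
  p * (K * (r * (r + S)) + R)   ≡⟨ e₁ p K r S R ⟩
  p * (r * (K * (r + S)) + R)   ≤⟨ *-monoʳ-≤ p (+-monoˡ-≤ R (*-monoʳ-≤ r K*[r+S]≤r*R)) ⟩
  p * (r * (r * R) + R)         ≡⟨ e₂ p r R ⟩
  R * (p * (r * r + 1))         ≤⟨ *-monoʳ-≤ R p*[r*r+1]≤q*r*[r+S] ⟩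
  R * (q * r * (r + S))         ≡⟨ e₃ R q r S ⟩
  q * (R * (r * (r + S)))       ∎
  where
    open ≤-Reasoning
    S = choose₂ e
    K = (r C e) * e !
    R = r ^ e
    B = forbiddenTotal k
    q = greedyCount r k
    p = r ^ k
    e₁ : ∀ p K r S R → p * (K * (r * (r + S)) + R) ≡ p * (r * (K * (r + S)) + R)
    e₁ = solve-∀
    e₂ : ∀ p r R → p * (r * (r * R) + R) ≡ R * (p * (r * r + 1))
    e₂ = solve-∀
    e₃ : ∀ R q r S → R * (q * r * (r + S)) ≡ q * (R * (r * (r + S)))
    e₃ = solve-∀
    e₄ : ∀ B r S → B * (r + S) + 1 ≡ B * r + suc (B * S)
    e₄ = solve-∀
    e₅ : ∀ p r B S → p * (r * r + 1) + B * p * (r + S) ≡ p * (r * r) + p * (B * (r + S) + 1)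
    e₅ = solve-∀
    e₆ : ∀ p r S → p * (r * r) + p * (r * S) ≡ r * p * (r + S)
    e₆ = solve-∀
    F≤r : ∀ {j} → j < k → forbiddenCount j ≤ r
    F≤r j<k = ≤-trans (forbiddenCount≤forbiddenTotal j<k) B≤r
    K*[r+S]≤r*R : K * (r + S) ≤ r * R
    K*[r+S]≤r*R = ≤-trans (*-monoˡ-≤ (r + S) (C*!≤P′ r e)) (P′-*-≤ r e)
    B*[r+S]<r*S : B * (r + S) + 1 ≤ r * S
    B*[r+S]<r*S = begin
      B * (r + S) + 1     ≡⟨ e₄ B r S ⟩
      B * r + suc (B * S) ≤⟨ +-monoʳ-≤ (B * r) BS<r ⟩
      B * r + r           ≡⟨ +-comm (B * r) r ⟩
      suc B * r           ≤⟨ *-monoˡ-≤ r B<S ⟩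
      S * r               ≡⟨ *-comm S r ⟩
      r * S               ∎
    p*[r*r+1]≤q*r*[r+S] : p * (r * r + 1) ≤ q * r * (r + S)
    p*[r*r+1]≤q*r*[r+S] = +-cancelʳ-≤ (B * p * (r + S)) _ _ (begin
      p * (r * r + 1) + B * p * (r + S)    ≡⟨ e₅ p r B S ⟩
      p * (r * r) + p * (B * (r + S) + 1)  ≤⟨ +-monoʳ-≤ (p * (r * r)) (*-monoʳ-≤ p B*[r+S]<r*S) ⟩
      p * (r * r) + p * (r * S)            ≡⟨ e₆ p r S ⟩
      r * p * (r + S)                      ≤⟨ *-monoˡ-≤ (r + S) (greedyCount-lower r k F≤r) ⟩
      (q * r + B * p) * (r + S)            ≡⟨ *-distribʳ-+ (r + S) (q * r) (B * p) ⟩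
      q * r * (r + S) + B * p * (r + S)    ∎)

cross-≤-trans : ∀ {a b c d e f} .{{_ : NonZero d}} → d * a ≤ c * b → f * c ≤ d * e → f * a ≤ e * b
cross-≤-trans {a} {b} {c} {d} {e} {f} da≤cb fc≤de = *-cancelˡ-≤ d (begin
  d * (f * a)   ≡⟨ e₁ d f a ⟩
  f * (d * a)   ≤⟨ *-monoʳ-≤ f da≤cb ⟩
  f * (c * b)   ≡⟨ e₂ f c b ⟩
  b * (f * c)   ≤⟨ *-monoʳ-≤ b fc≤de ⟩
  b * (d * e)   ≡⟨ e₃ b d e ⟩
  d * (e * b)   ∎)
  where
    open ≤-Reasoning
    e₁ : ∀ d f a → d * (f * a) ≡ f * (d * a)
    e₁ = solve-∀
    e₂ : ∀ f c b → f * (c * b) ≡ b * (f * c)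
    e₂ = solve-∀
    e₃ : ∀ b d e → b * (d * e) ≡ d * (e * b)
    e₃ = solve-∀

-- Residue colourings of K_{m r}

module Cyclic (r : ℕ) .{{_ : NonZero r}} where

  _⊕_ : Fin r → Fin r → Fin r
  a ⊕ b = (toℕ a + toℕ b) mod r

  _⊖_ : Fin r → Fin r → Fin r
  a ⊖ b = (toℕ a + (r ∸ toℕ b)) mod r

  toℕ-mod : (n : ℕ) → toℕ (n mod r) ≡ n % r
  toℕ-mod n = toℕ-fromℕ< (m%n<n n r)

  ⊕-comm : ∀ a b → a ⊕ b ≡ b ⊕ a
  ⊕-comm a b = cong (_mod r) (+-comm (toℕ a) (toℕ b))

  ⊕-⊖ : ∀ a b → (a ⊕ b) ⊖ b ≡ a
  ⊕-⊖ a b = toℕ-injective (begin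
    toℕ ((a ⊕ b) ⊖ b)                      ≡⟨ toℕ-mod (toℕ (a ⊕ b) + (r ∸ B)) ⟩
    (toℕ (a ⊕ b) + (r ∸ B)) % r            ≡⟨ cong (λ n → (n + (r ∸ B)) % r) (toℕ-mod (A + B)) ⟩
    ((A + B) % r + (r ∸ B)) % r            ≡⟨ %-distribˡ-+ ((A + B) % r) (r ∸ B) r ⟩
    ((A + B) % r % r + (r ∸ B) % r) % r    ≡⟨ cong (λ n → (n + (r ∸ B) % r) % r) (m%n%n≡m%n (A + B) r) ⟩
    ((A + B) % r + (r ∸ B) % r) % r        ≡⟨ %-distribˡ-+ (A + B) (r ∸ B) r ⟨
    (A + B + (r ∸ B)) % r                  ≡⟨ cong (_% r) (+-assoc A B (r ∸ B)) ⟩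
    (A + (B + (r ∸ B))) % r                ≡⟨ cong (λ n → (A + n) % r) (m+[n∸m]≡n (<⇒≤ (toℕ<n b))) ⟩
    (A + r) % r                            ≡⟨ [m+n]%n≡m%n A r ⟩
    A % r                                  ≡⟨ m<n⇒m%n≡m (toℕ<n a) ⟩
    A                                      ∎)
    where
      open ≡-Reasoning
      A = toℕ a
      B = toℕ b

  ⊕-identityˡ : ∀ {z} a → toℕ z ≡ 0 → z ⊕ a ≡ a
  ⊕-identityˡ {z} a z≡0 = toℕ-injective (begin
    toℕ (z ⊕ a)          ≡⟨ toℕ-mod (toℕ z + toℕ a) ⟩
    (toℕ z + toℕ a) % r  ≡⟨ cong (λ n → (n + toℕ a) % r) z≡0 ⟩
    toℕ a % r            ≡⟨ m<n⇒m%n≡m (toℕ<n a) ⟩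
    toℕ a                ∎)
    where open ≡-Reasoning

module ResidueColouring (r : ℕ) .{{_ : NonZero r}} (m : ℕ) where

  open Cyclic r

  residue : Fin (m * r) → Fin r
  residue = remainder {m} r

  open SumColouring _≟_ _≟_ _⊕_ _⊖_ ⊕-comm ⊕-⊖ residue public

  residue-fibre-≤ : ∀ a → count (λ v → residue v ≟ a) (allFin (m * r)) ≤ m
  residue-fibre-≤ a = begin
    count (λ v → residue v ≟ a) (allFin (m * r))
      ≤⟨ Unique-⊆-length (Unique.filter⁺ _ (allFin⁺ (m * r))) fibre⊆ ⟩
    length (map (λ i → combine i a) (allFin m))       ≡⟨ trans (length-map _ (allFin m)) (length-tabulate id) ⟩
    m                                                 ∎
    where
      open ≤-Reasoning
      fibre⊆ : filter (λ v → residue v ≟ a) (allFin (m * r)) ⊆ map (λ i → combine i a) (allFin m)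
      fibre⊆ {v} v∈ = subst (_∈ _) (trans (cong (combine (quotient {m} r v)) (sym residue≡a)) (combine-remQuot {m} r v))
                            (∈-map⁺ (λ i → combine i a) (∈-allFin (quotient {m} r v)))
        where
          residue≡a : residue v ≡ a
          residue≡a = proj₂ (∈-filter⁻ (λ v → residue v ≟ a) {xs = allFin (m * r)} v∈)

  open Counting (allFin (m * r)) (allFin⁺ (m * r)) r m (trans (length-tabulate id) (*-comm m r)) residue-fibre-≤ public

  rainbowCount-≥ : (t : ℕ) → greedyCount r t * m ^ t ≤ t ! * rainbowCount t colour
  rainbowCount-≥ t = ≤-trans (count-combinations t) (*-monoʳ-≤ (t !)
    (count-mono stronglyRainbow? (λ S → UniqueDec.unique? _≟_ (colours S)) proj₂ (combinations t (allFin (m * r)))))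

  colour-surjective : 2 ≤ m → IsRColoring (m * r) r colour
  colour-surjective 2≤m k = combine 0ᵐ 0ʳ , combine 1ᵐ k , combine-monoˡ-< 0ʳ k 0<1 , colour≡k
    where
      0<r = >-nonZero⁻¹ r
      0ᵐ 1ᵐ : Fin m
      0ᵐ = fromℕ< (<-trans z<s 2≤m)
      1ᵐ = fromℕ< 2≤m
      0ʳ : Fin r
      0ʳ = fromℕ< 0<r
      0<1 : toℕ 0ᵐ < toℕ 1ᵐ
      0<1 = subst₂ _<_ (sym (toℕ-fromℕ< _)) (sym (toℕ-fromℕ< _)) z<s
      colour≡k : colour (combine 0ᵐ 0ʳ) (combine 1ᵐ k) ≡ k
      colour≡k = begin
        residue (combine 0ᵐ 0ʳ) ⊕ residue (combine 1ᵐ k)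
          ≡⟨ cong₂ _⊕_ (cong proj₂ (remQuot-combine 0ᵐ 0ʳ)) (cong proj₂ (remQuot-combine 1ᵐ k)) ⟩
        0ʳ ⊕ k
          ≡⟨ ⊕-identityˡ k (toℕ-fromℕ< 0<r) ⟩
        k ∎
        where open ≡-Reasoning

  rainbowDensity-≥ : (t : ℕ) → ((m * r) C t) * greedyCount r t ≤ r ^ t * rainbowCount t colour
  rainbowDensity-≥ t = *-cancelˡ-≤ (t !) {{t !≢0}} (begin
    t ! * (c * q)                 ≡⟨ e₁ (t !) c q ⟩
    c * t ! * q                   ≤⟨ *-monoˡ-≤ q (≤-trans (C*!≤P′ (m * r) t) (P′≤^ (m * r) t)) ⟩
    (m * r) ^ t * q               ≡⟨ cong (_* q) (*-^ m r t) ⟩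
    m ^ t * r ^ t * q             ≡⟨ e₂ (m ^ t) (r ^ t) q ⟩
    r ^ t * (q * m ^ t)           ≤⟨ *-monoʳ-≤ (r ^ t) (rainbowCount-≥ t) ⟩
    r ^ t * (t ! * rainbowCount t colour) ≡⟨ e₃ (r ^ t) (t !) (rainbowCount t colour) ⟩
    t ! * (r ^ t * rainbowCount t colour) ∎)
    where
      open ≤-Reasoning
      c = (m * r) C t
      q = greedyCount r t
      e₁ : ∀ f c q → f * (c * q) ≡ c * f * q
      e₁ = solve-∀
      e₂ : ∀ x y q → x * y * q ≡ y * (q * x)
      e₂ = solve-∀
      e₃ : ∀ y f n → y * (f * n) ≡ f * (y * n)
      e₃ = solve-∀

-- Separation from the common value

module _ where

  open import Data.Integer using (+_)

  toℚᵘ-frac : ∀ a b → toℚᵘ (frac a (suc b)) ≃ᵘ mkℚᵘ (+ a) b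
  toℚᵘ-frac a b = ℚ.toℚᵘ-fromℚᵘ (mkℚᵘ (+ a) b)

  0<frac : ∀ {a b} → 0 < a → 0 < b → 0ℚ <ℚ frac a b
  0<frac {suc a} {suc b} _ _ = ℚ.positive⁻¹ (frac (suc a) (suc b)) {{ℚ.normalize-pos (suc a) (suc b)}}

  frac-+-≤ : ∀ {a b c d D} → 0 < b → 0 < d → 0 < D → b * (c * D + d) ≤ a * (d * D) →
             frac c d +ℚ frac 1 D ≤ℚ frac a b
  frac-+-≤ {a} {suc b} {c} {suc d} {suc D} _ _ _ cross = ℚ.toℚᵘ-cancel-≤
    (ℚᵘ.≤-respˡ-≃ (ℚᵘ.≃-sym (ℚᵘ.≃-trans (ℚ.toℚᵘ-homo-+ (frac c (suc d)) (frac 1 (suc D)))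
                                         (ℚᵘ.+-cong (toℚᵘ-frac c d) (toℚᵘ-frac 1 D))))
    (ℚᵘ.≤-respʳ-≃ (ℚᵘ.≃-sym (toℚᵘ-frac a b))
      (ℚᵘ.*≤* (subst₂ ℤ._≤_ (sym lhs) (sym rhs)
                 (ℤ.+≤+ (subst (_≤ a * (suc d * suc D)) (e (suc b) c (suc d) (suc D)) cross))))))
    where
      e : ∀ b c d D → b * (c * D + d) ≡ (c * D + 1 * d) * b
      e = solve-∀
      lhs : ((+ c ℤ.* + suc D) ℤ.+ (+ 1 ℤ.* + suc d)) ℤ.* + suc b ≡ + ((c * suc D + 1 * suc d) * suc b)
      lhs = trans (cong (ℤ._* + suc b) (trans (cong₂ ℤ._+_ (sym (ℤ.pos-* c (suc D))) (sym (ℤ.pos-* 1 (suc d))))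
                                              (sym (ℤ.pos-+ (c * suc D) (1 * suc d)))))
                  (sym (ℤ.pos-* (c * suc D + 1 * suc d) (suc b)))
      rhs : + a ℤ.* + (suc d * suc D) ≡ + (a * (suc d * suc D))
      rhs = sym (ℤ.pos-* a (suc d * suc D))

≤-+-∣-∣-< : ∀ {x y ε} → 0ℚ ≤ℚ ε → y +ℚ ε ≤ℚ x → ¬ ℚ.∣ x -ℚ y ∣ <ℚ ε
≤-+-∣-∣-< {x} {y} {ε} 0≤ε y+ε≤x ∣x-y∣<ε = ℚ.<-irrefl refl (ℚ.<-≤-trans x<y+ε y+ε≤x)
  where
    y≤x : y ≤ℚ x
    y≤x = ℚ.≤-trans (subst (_≤ℚ y +ℚ ε) (ℚ.+-identityʳ y) (ℚ.+-monoʳ-≤ y 0≤ε)) y+ε≤x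
    0≤x-y : 0ℚ ≤ℚ x -ℚ y
    0≤x-y = subst (_≤ℚ x -ℚ y) (ℚ.+-inverseʳ y) (ℚ.+-monoˡ-≤ (ℚ.- y) y≤x)
    x-y+y≡x : (x -ℚ y) +ℚ y ≡ x
    x-y+y≡x = trans (ℚ.+-assoc x (ℚ.- y) y) (trans (cong (x +ℚ_) (ℚ.+-inverseˡ y)) (ℚ.+-identityʳ x))
    x<y+ε : x <ℚ y +ℚ ε
    x<y+ε = subst₂ _<ℚ_ x-y+y≡x (ℚ.+-comm ε y)
                   (ℚ.+-monoˡ-< y (subst (_<ℚ ε) (ℚ.0≤p⇒∣p∣≡p 0≤x-y) ∣x-y∣<ε))

-- Q need not be decidable, so the maximum exists only under double negation.
¬¬-maximum : (Q : ℕ → Set) {bound : ℕ} → (∀ {k} → Q k → k ≤ bound) → ∀ {k₀} → Q k₀ →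
             ¬ ¬ (∃[ M ] (Q M × (∀ {k} → Q k → k ≤ M)))
¬¬-maximum Q {bound} ≤bound {k₀} q₀ = search bound q₀ (m≤n+m bound k₀)
  where
    search : ∀ fuel {k} → Q k → bound ≤ k + fuel → ¬ ¬ (∃[ M ] (Q M × (∀ {k} → Q k → k ≤ M)))
    search zero {k} q bound≤k ¬max =
      ¬max (k , q , λ q′ → ≤-trans (≤bound q′) (≤-trans bound≤k (≤-reflexive (+-identityʳ k))))
    search (suc fuel) {k} q bound≤k ¬max = ¬max (k , q , maximal)
      where
        maximal : ∀ {k′} → Q k′ → k′ ≤ k
        maximal {k′} q′ with k′ ≤? k
        ... | yes k′≤k = k′≤k
        ... | no k′≰k = ⊥-elim (search fuel q′ bound≤k′+fuel ¬max)
          where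
            bound≤k′+fuel : bound ≤ k′ + fuel
            bound≤k′+fuel = ≤-trans bound≤k (≤-trans (≤-reflexive (+-suc k fuel)) (+-monoˡ-≤ fuel (≰⇒> k′≰k)))

¬¬-maxRainbow : ∀ t {n r} {c : EdgeCol n r} → IsRColoring n r c → ¬ ¬ (∃[ M ] IsMaxRainbow t n r M)
¬¬-maxRainbow t {n} {r} {c} c-surjective ¬max =
  ¬¬-maximum Attained (λ (_ , _ , count≡k) → subst (_≤ length candidates) count≡k (length-filter _ candidates))
    (c , c-surjective , refl)
    (λ (M , attained , maximal) → ¬max (M , attained , λ c′ c′-surjective → maximal (c′ , c′-surjective , refl)))
  where
    candidates = combinations t (allFin n)
    Attained : ℕ → Set
    Attained k = ∃[ c ] (IsRColoring n r c × rainbowCount t c ≡ k)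

rainbowUncommon : ∀ {t r} → 4 ≤ t → forbiddenTotal t ≤ r → suc (forbiddenTotal t * choose₂ (t C 2)) ≤ r →
                  RainbowUncommon t r
rainbowUncommon {t} {r@(suc _)} 4≤t B≤r BS<r tendsTo = ¬¬-maxRainbow t (colour-surjective 2≤m) λ (M , isMax) →
  ≤-+-∣-∣-< (ℚ.<⇒≤ 0<ε)
    (frac-+-≤ (C-pos t≤n) (m^n>0 r e) z<s
      (≤-trans common<density (*-monoˡ-≤ _ (proj₂ isMax colour (colour-surjective 2≤m)))))
    (proj₂ (tendsTo ε 0<ε) n N≤n M isMax)
  where
    e = t C 2
    D = r * (r + choose₂ e)
    ε = frac 1 D
    0<ε : 0ℚ <ℚ ε
    0<ε = 0<frac {1} {D} z<s z<s
    N = proj₁ (tendsTo ε 0<ε)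
    m = 2 + (N + t)
    n = m * r
    open ResidueColouring r m
    2≤m : 2 ≤ m
    2≤m = m≤m+n 2 (N + t)
    N≤n : N ≤ n
    N≤n = ≤-trans (≤-trans (m≤m+n N t) (m≤n+m _ 2)) (m≤m*n m r)
    t≤n : t ≤ n
    t≤n = ≤-trans (≤-trans (m≤n+m t N) (m≤n+m _ 2)) (m≤m*n m r)
    common<density : (n C t) * ((r C e) * e ! * D + r ^ e) ≤ rainbowCount t colour * (r ^ e * D)
    common<density = cross-≤-trans {c = greedyCount r t} {d = r ^ t} {f = n C t} {{m^n≢0 r t}}
      (greedyCount-gap r t e (forbiddenTotal<choose₂[C2] 4≤t) B≤r BS<r) (rainbowDensity-≥ t)

theorem8 : (t : ℕ) → 4 ≤ t →
    ∃[ rt ] ((t C 2 ≤ rt) × ((r : ℕ) → rt ≤ r → RainbowUncommon t r))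
theorem8 t 4≤t = threshold , ≤-trans (m≤m+n e B) (m≤m+n (e + B) _) , λ r threshold≤r →
  rainbowUncommon 4≤t (≤-trans (≤-trans (m≤n+m B e) (m≤m+n (e + B) _)) threshold≤r)
                      (≤-trans (m≤n+m _ (e + B)) threshold≤r)
  where
    e = t C 2
    B = forbiddenTotal t
    threshold = e + B + suc (B * choose₂ e)
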